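{- Let $G$ be a finite simple graph. (i) If $i_{\alpha(G)}(G)=1$, $i_{\alpha(G)-1}(G)=|V(G)|$, and the unique maximum independent set $S$ satisfies $|N(u)\cap S|=2$ for every vertex $u\in V(G)\setminus S$, then $I(G;x)$ is symmetric and unimodal. (ii) If $G$ is claw-free with $i_{\alpha(G)}(G)=1$ and $i_{\alpha(G)-1}(G)=|V(G)|$, then $I(G;x)$ is symmetric and unimodal.
   Context: For a finite simple graph $G$, $i_k(G)$ is the number of independent sets of size $k$ ($i_0(G)=1$), $\alpha(G)$ is the maximum size of an independent set, and $I(G;x)=\sum_{k=0}^{\alpha(G)} i_k(G)x^k$. $N(u)$ is the set of neighbours of $u$. A graph is claw-free if it has no induced subgraph isomorphic to $K_{1,3}$. A polynomial $\sum_{k=0}^n a_kx^k$ of degree $n$ with nonnegative coefficients is symmetric if $a_k=a_{n-k}$ for all $k$, and unimodal if there is $m$ with $a_0\le\cdots\le a_m\ge\cdots\ge a_n$. -}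

module Defs where

open import Data.Nat using (ℕ; zero; suc; _≡ᵇ_; _⊔_; _≤_; _<_)
open import Data.Bool using (Bool; true; false; _∧_; not; T)
open import Data.Fin using (Fin)
open import Data.Fin.Subset using (Subset; _∈_; _∉_; ∣_∣; _∩_)
open import Data.Vec using (Vec; []; _∷_; lookup; tabulate)
open import Data.List using (List; []; _∷_; map; _++_; foldr; length; filterᵇ; allFin)
open import Data.Product using (Σ; _×_; ∃-syntax)
open import Relation.Binary.PropositionalEquality using (_≡_; _≢_)

record Graph : Set where
  field
    n     : ℕ
    Adj   : Fin n → Fin n → Bool
    sym   : ∀ i j → Adj i j ≡ Adj j i
    irrefl : ∀ i → Adj i i ≡ false
open Graph public

∣V∣ : Graph → ℕ
∣V∣ G = n G

allSubsets : (m : ℕ) → List (Subset m)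
allSubsets zero = [] ∷ []
allSubsets (suc m) = map (true ∷_) (allSubsets m) ++ map (false ∷_) (allSubsets m)

allᵇ : {A : Set} → (A → Bool) → List A → Bool
allᵇ p [] = true
allᵇ p (x ∷ xs) = p x ∧ allᵇ p xs

isIndep : (G : Graph) → Subset (n G) → Bool
isIndep G S = allᵇ (λ i → allᵇ (λ j → not (lookup S i ∧ lookup S j ∧ Adj G i j)) (allFin (n G))) (allFin (n G))

Independent : (G : Graph) → Subset (n G) → Set
Independent G S = T (isIndep G S)

i : Graph → ℕ → ℕ
i G k = length (filterᵇ (λ S → isIndep G S ∧ (∣ S ∣ ≡ᵇ k)) (allSubsets (n G)))

α : Graph → ℕ
α G = foldr _⊔_ 0 (map ∣_∣ (filterᵇ (isIndep G) (allSubsets (n G))))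

N : (G : Graph) → Fin (n G) → Subset (n G)
N G u = tabulate (Adj G u)

ClawFree : Graph → Set
ClawFree G = ∀ (u a b c : Fin (n G)) →
  Adj G u a ≡ true → Adj G u b ≡ true → Adj G u c ≡ true →
  a ≢ b → a ≢ c → b ≢ c →
  Adj G a b ≡ false → Adj G a c ≡ false → Adj G b c ≡ false → Data.Empty.⊥
  where import Data.Empty

-- The independence polynomial I(G;x) = Σ_{k=0}^{α} i_k x^k (degree α(G)).
-- Symmetric: i_k = i_{α-k} for all 0 ≤ k ≤ α.
Symmetric : Graph → Set
Symmetric G = ∀ k → k ≤ α G → i G k ≡ i G (α G Data.Nat.∸ k)

Unimodal : Graph → Set
Unimodal G = ∃[ m ] (m ≤ α G
  × (∀ k → k < m → i G k ≤ i G (suc k))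
  × (∀ k → m ≤ k → k < α G → i G (suc k) ≤ i G k))

-- Hypothesis i_{α-1}(G) = |V(G)| (with i_{-1} = 0 convention; vacuous only when α = 0,
-- which forces |V(G)| = 0 so it agrees with 0 = |V(G)|).
PrevCountIsV : Graph → Set
PrevCountIsV G = ∀ k → suc k ≡ α G → i G k ≡ ∣V∣ G

-- Let S be the unique maximum independent set. In both parts every vertex outside S has exactly
-- two neighbours in S (in the claw-free case fewer would make S ∖ N(u) + u an independent set at
-- least as large as S, and more would give a claw). The sets S − u (u ∈ S) and S ∖ N(u) + u
-- (u ∉ S) are then |V| distinct independent (α−1)-sets, hence all of them; comparing them with
-- {v, w} ∪ S ∖ (N(v) ∪ N(w)) shows that non-adjacent v, w ∉ S have no common neighbour in S.
-- Hence an independent set Z is W ∪ A with W = Z ∖ S and A any subset of T = S ∖ N(W), where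
-- |T| = α − 2|W|. Complementing A inside T gives i_k = i_{α−k}, and the bracket-matching
-- injection from j-subsets to (j+1)-subsets of T gives i_k ≤ i_{k+1} whenever 2k < α.
module Submission where

open import Defs hiding (sym)
open import Data.Bool using (Bool; true; false; T; _∧_; _∨_; not; _≟_)
open import Data.Bool.Properties
  using (∧-conicalˡ; ∧-conicalʳ; ∨-conicalˡ; ∨-conicalʳ; ∧-comm; ∧-zeroʳ; ∨-identityʳ; ∧-distribˡ-∨)
open import Data.Empty using (⊥; ⊥-elim)
open import Data.Fin as Fin using (Fin; zero; suc)
import Data.Fin.Properties as Fin
open import Data.Fin.Subset using (Subset; ∣_∣; _∩_; _∉_)
open import Data.List using (List; []; _∷_; map; _++_; length; filterᵇ; foldr; allFin)
import Data.List.Membership.DecPropositional as DecMembership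
open import Data.List.Membership.Propositional using (_∈_)
open import Data.List.Membership.Propositional.Properties
  using (∈-∃++; ∈-++⁻; ∈-++⁺ˡ; ∈-++⁺ʳ; ∈-map⁺; ∈-map⁻; ∈-filter⁺; ∈-filter⁻; ∈-allFin)
open import Data.List.Properties using (length-map; length-++; length-tabulate)
open import Data.List.Relation.Binary.Subset.Propositional using (_⊆_)
open import Data.List.Relation.Unary.All as All using (All; []; _∷_)
open import Data.List.Relation.Unary.All.Properties using (all-filter; ¬Any⇒All¬; map⁺; tabulate⁺)
open import Data.List.Relation.Unary.AllPairs using ([]; _∷_)
open import Data.List.Relation.Unary.Any using (here; there)
open import Data.List.Relation.Unary.Unique.Propositional using (Unique)
import Data.List.Relation.Unary.Unique.Propositional.Properties as Unique
open import Data.Nat as ℕ using (ℕ; zero; suc; _+_; _*_; _∸_; _≤_; _<_; z≤n; s≤s; _⊔_)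
open import Data.Nat.Properties hiding (_≟_)
open import Algebra.Properties.Semiring.Sum +-*-semiring
  using (sum; sum-cong-≗; ∑-distrib-+; ∑-comm; *-distribˡ-sum; sum-replicate-zero)
open import Data.Nat.Tactic.RingSolver using (solve-∀)
open import Data.Product using (_×_; _,_; proj₁; proj₂; ∃)
open import Data.Sum using (_⊎_; inj₁; inj₂)
open import Data.Vec as Vec using (Vec; []; _∷_; lookup; tabulate)
open import Data.Vec.Properties
  using (lookup∘tabulate; tabulate∘lookup; tabulate-cong; ≡-dec; lookup-zipWith; []=⇒lookup)
open import Function using (_∘′_)
open import Relation.Binary.PropositionalEquality
open import Relation.Nullary using (¬_; yes; no; does)
open import Relation.Nullary.Decidable using (T?)

-- Counting subsets

Unique⇒length≤ : {A : Set} (xs ys : List A) → Unique xs → xs ⊆ ys → length xs ≤ length ys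
Unique⇒length≤ [] ys _ _ = z≤n
Unique⇒length≤ (x ∷ xs) ys (x∉xs ∷ xs!) xs⊆ys with ∈-∃++ (xs⊆ys (here refl))
... | us , vs , refl = begin
  suc (length xs)           ≤⟨ s≤s (Unique⇒length≤ xs (us ++ vs) xs! xs⊆us++vs) ⟩
  suc (length (us ++ vs))   ≡⟨ cong suc (length-++ us) ⟩
  suc (length us + length vs) ≡⟨ +-suc (length us) (length vs) ⟨
  length us + length (x ∷ vs) ≡⟨ length-++ us ⟨
  length (us ++ x ∷ vs)     ∎
  where
  open ≤-Reasoning
  xs⊆us++vs : xs ⊆ us ++ vs
  xs⊆us++vs y∈xs with ∈-++⁻ us (xs⊆ys (there y∈xs))
  ... | inj₁ y∈us = ∈-++⁺ˡ y∈us
  ... | inj₂ (here refl) = ⊥-elim (All.lookup x∉xs y∈xs refl)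
  ... | inj₂ (there y∈vs) = ∈-++⁺ʳ us y∈vs

map⁺-injectiveOn : {A B : Set} {P : A → Set} (f : A → B) {xs : List A} →
                   (∀ {x y} → P x → P y → f x ≡ f y → x ≡ y) →
                   All P xs → Unique xs → Unique (map f xs)
map⁺-injectiveOn f inj [] [] = []
map⁺-injectiveOn f inj (px ∷ pxs) (x∉xs ∷ xs!) =
  images-distinct pxs x∉xs ∷ map⁺-injectiveOn f inj pxs xs!
  where
  images-distinct : ∀ {ys} → All _ ys → All (_ ≢_) ys → All (f _ ≢_) (map f ys)
  images-distinct [] [] = []
  images-distinct (py ∷ pys) (x≢y ∷ x≢ys) = (λ e → x≢y (inj px py e)) ∷ images-distinct pys x≢ys

∈-allSubsets : ∀ {m} (X : Subset m) → X ∈ allSubsets m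
∈-allSubsets [] = here refl
∈-allSubsets {suc m} (true ∷ X) = ∈-++⁺ˡ (∈-map⁺ (true ∷_) (∈-allSubsets X))
∈-allSubsets {suc m} (false ∷ X) =
  ∈-++⁺ʳ (map (true ∷_) (allSubsets m)) (∈-map⁺ (false ∷_) (∈-allSubsets X))

allSubsets-unique : ∀ m → Unique (allSubsets m)
allSubsets-unique zero = [] ∷ []
allSubsets-unique (suc m) =
  Unique.++⁺ (Unique.map⁺ ∷-injectiveʳ (allSubsets-unique m))
             (Unique.map⁺ ∷-injectiveʳ (allSubsets-unique m)) heads-differ
  where
  ∷-injectiveʳ : ∀ {b} {X Y : Subset m} → b ∷ X ≡ b ∷ Y → X ≡ Y
  ∷-injectiveʳ refl = refl
  heads-differ : ∀ {X} → ¬ (X ∈ map (true ∷_) (allSubsets m) × X ∈ map (false ∷_) (allSubsets m))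
  heads-differ (p , q) with ∈-map⁻ (true ∷_) p | ∈-map⁻ (false ∷_) q
  ... | _ , _ , refl | _ , _ , ()

count : ∀ {m} → (Subset m → Bool) → ℕ
count {m} Q = length (filterᵇ Q (allSubsets m))

∈-count⁺ : ∀ {m} (Q : Subset m → Bool) {X} → T (Q X) → X ∈ filterᵇ Q (allSubsets m)
∈-count⁺ Q {X} QX = ∈-filter⁺ (λ Y → T? (Q Y)) (∈-allSubsets X) QX

∈-count⁻ : ∀ {m} (Q : Subset m → Bool) {X} → X ∈ filterᵇ Q (allSubsets m) → T (Q X)
∈-count⁻ {m} Q X∈ = proj₂ (∈-filter⁻ (λ Y → T? (Q Y)) {xs = allSubsets m} X∈)

length≤count : ∀ {m} (Q : Subset m → Bool) (Xs : List (Subset m)) →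
               Unique Xs → All (T ∘′ Q) Xs → length Xs ≤ count Q
length≤count Q Xs Xs! QXs = Unique⇒length≤ Xs _ Xs! (λ X∈ → ∈-count⁺ Q (All.lookup QXs X∈))

count-≤ : ∀ {m} (P Q : Subset m → Bool) (f : Subset m → Subset m) →
          (∀ X → T (P X) → T (Q (f X))) →
          (∀ X Y → T (P X) → T (P Y) → f X ≡ f Y → X ≡ Y) → count P ≤ count Q
count-≤ {m} P Q f f-maps f-inj = begin
  count P           ≡⟨ length-map f Ps ⟨
  length (map f Ps) ≤⟨ length≤count Q (map f Ps) fPs-unique (map⁺ (All.map (λ {X} → f-maps X) PPs)) ⟩
  count Q           ∎
  where
  open ≤-Reasoning
  Ps : List (Subset m)
  Ps = filterᵇ P (allSubsets m)
  PPs : All (T ∘′ P) Ps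
  PPs = all-filter (λ X → T? (P X)) (allSubsets m)
  fPs-unique : Unique (map f Ps)
  fPs-unique = map⁺-injectiveOn f (λ {X} {Y} → f-inj X Y) PPs
                 (Unique.filter⁺ (λ X → T? (P X)) (allSubsets-unique m))

count≡1⇒∃ : ∀ {m} (Q : Subset m → Bool) → count Q ≡ 1 → ∃ λ X → T (Q X)
count≡1⇒∃ {m} Q c≡1 with filterᵇ Q (allSubsets m) in eq
... | X ∷ _ = X , ∈-count⁻ Q (subst (X ∈_) (sym eq) (here refl))

-- Indicator sums

bool→ℕ : Bool → ℕ
bool→ℕ true = 1
bool→ℕ false = 0

#_ : ∀ {m} → (Fin m → Bool) → ℕ
# f = sum (λ j → bool→ℕ (f j))

not≡true⇒≡false : ∀ {x} → not x ≡ true → x ≡ false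
not≡true⇒≡false {false} _ = refl

_==_ : ∀ {m} → Fin m → Fin m → Bool
a == b = does (a Fin.≟ b)

==-refl : ∀ {m} (a : Fin m) → (a == a) ≡ true
==-refl a with a Fin.≟ a
... | yes _ = refl
... | no a≢a = ⊥-elim (a≢a refl)

==⇒≡ : ∀ {m} (a b : Fin m) → (a == b) ≡ true → a ≡ b
==⇒≡ a b e with a Fin.≟ b
... | yes a≡b = a≡b

≢⇒==false : ∀ {m} {a b : Fin m} → a ≢ b → (a == b) ≡ false
≢⇒==false {a = a} {b} a≢b with a Fin.≟ b
... | yes a≡b = ⊥-elim (a≢b a≡b)
... | no _ = refl

#-cong : ∀ {m} {f g : Fin m → Bool} → (∀ j → f j ≡ g j) → # f ≡ # g
#-cong f≗g = sum-cong-≗ (λ j → cong bool→ℕ (f≗g j))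

#-mono : ∀ {m} {f g : Fin m → Bool} → (∀ j → f j ≡ true → g j ≡ true) → # f ≤ # g
#-mono {zero} f⊆g = z≤n
#-mono {suc m} {f} {g} f⊆g = +-mono-≤ (head≤ (f zero) refl) (#-mono (λ j → f⊆g (suc j)))
  where
  head≤ : ∀ b → f zero ≡ b → bool→ℕ b ≤ bool→ℕ (g zero)
  head≤ false _ = z≤n
  head≤ true f₀ rewrite f⊆g zero f₀ = ≤-refl

#-pointwise : ∀ {m} {f g h : Fin m → Bool} →
              (∀ j → bool→ℕ (f j) ≡ bool→ℕ (g j) + bool→ℕ (h j)) → # f ≡ # g + # h
#-pointwise {g = g} {h} e = trans (sum-cong-≗ e) (∑-distrib-+ (λ j → bool→ℕ (g j)) (λ j → bool→ℕ (h j)))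

#-split : ∀ {m} (f g : Fin m → Bool) → # f ≡ # (λ j → f j ∧ g j) + # (λ j → f j ∧ not (g j))
#-split f g = #-pointwise (λ j → split (f j) (g j))
  where
  split : ∀ x y → bool→ℕ x ≡ bool→ℕ (x ∧ y) + bool→ℕ (x ∧ not y)
  split true true = refl
  split true false = refl
  split false _ = refl

#-∨-disjoint : ∀ {m} (f g : Fin m → Bool) → (∀ j → f j ≡ true → g j ≡ false) →
               # (λ j → f j ∨ g j) ≡ # f + # g
#-∨-disjoint f g disjoint = #-pointwise (λ j → union (f j) (g j) (disjoint j))
  where
  union : ∀ x y → (x ≡ true → y ≡ false) → bool→ℕ (x ∨ y) ≡ bool→ℕ x + bool→ℕ y
  union true true x⇒¬y with () ← x⇒¬y refl
  union true false _ = refl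
  union false _ _ = refl

#-∨+#-∧ : ∀ {m} (f g : Fin m → Bool) → # (λ j → f j ∨ g j) + # (λ j → f j ∧ g j) ≡ # f + # g
#-∨+#-∧ f g = begin
  # (λ j → f j ∨ g j) + # (λ j → f j ∧ g j)
    ≡⟨ ∑-distrib-+ (λ j → bool→ℕ (f j ∨ g j)) (λ j → bool→ℕ (f j ∧ g j)) ⟨
  sum (λ j → bool→ℕ (f j ∨ g j) + bool→ℕ (f j ∧ g j))
    ≡⟨ sum-cong-≗ (λ j → inclusion–exclusion (f j) (g j)) ⟩
  sum (λ j → bool→ℕ (f j) + bool→ℕ (g j))
    ≡⟨ ∑-distrib-+ (λ j → bool→ℕ (f j)) (λ j → bool→ℕ (g j)) ⟩
  # f + # g ∎
  where
  open ≡-Reasoning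
  inclusion–exclusion : ∀ x y → bool→ℕ (x ∨ y) + bool→ℕ (x ∧ y) ≡ bool→ℕ x + bool→ℕ y
  inclusion–exclusion true true = refl
  inclusion–exclusion true false = refl
  inclusion–exclusion false true = refl
  inclusion–exclusion false false = refl

#-false : ∀ {m} (f : Fin m → Bool) → (∀ j → f j ≡ false) → # f ≡ 0
#-false {m} f f≡false = trans (#-cong f≡false) (sum-replicate-zero m)

#-== : ∀ {m} (v : Fin m) → # (_== v) ≡ 1
#-== {suc m} zero = cong suc (#-false {m} (λ j → suc j == zero) (λ _ → refl))
#-== {suc m} (suc v) = trans (#-cong ==-suc) (#-== v)
  where
  ==-suc : ∀ j → (suc j == suc v) ≡ (j == v)
  ==-suc j with j Fin.≟ v
  ... | yes refl = refl
  ... | no _ = refl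

#-remove : ∀ {m} (f : Fin m → Bool) {v : Fin m} → f v ≡ true →
           # f ≡ suc (# (λ j → f j ∧ not (j == v)))
#-remove f {v} fv = trans (#-split f (_== v)) (cong (_+ # (λ j → f j ∧ not (j == v))) only-v)
  where
  only-v : # (λ j → f j ∧ (j == v)) ≡ 1
  only-v = trans (#-cong f∧==) (#-== v)
    where
    f∧== : ∀ j → (f j ∧ (j == v)) ≡ (j == v)
    f∧== j with j Fin.≟ v | f j in fj
    ... | yes refl | true = refl
    ... | yes refl | false = trans (sym fj) fv
    ... | no _ | true = refl
    ... | no _ | false = refl

#-pos : ∀ {m} (f : Fin m → Bool) {v : Fin m} → f v ≡ true → 1 ≤ # f
#-pos f fv rewrite #-remove f fv = s≤s z≤n

#-pos⇒∃ : ∀ {m} (f : Fin m → Bool) → 1 ≤ # f → ∃ λ j → f j ≡ true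
#-pos⇒∃ {suc m} f pos with f zero in f₀
... | true = zero , f₀
... | false with #-pos⇒∃ (λ j → f (suc j)) pos
... | j , fj = suc j , fj

any : ∀ {m} → (Fin m → Bool) → Bool
any {zero} f = false
any {suc m} f = f zero ∨ any (λ j → f (suc j))

any⁺ : ∀ {m} (f : Fin m → Bool) {j : Fin m} → f j ≡ true → any f ≡ true
any⁺ {suc m} f {zero} fj rewrite fj = refl
any⁺ {suc m} f {suc j} fj with f zero
... | true = refl
... | false = any⁺ (λ j → f (suc j)) fj

any-false : ∀ {m} (f : Fin m → Bool) → (∀ j → f j ≡ false) → any f ≡ false
any-false {zero} f _ = refl
any-false {suc m} f f≡false rewrite f≡false zero = any-false (λ j → f (suc j)) (λ j → f≡false (suc j))

any-cong : ∀ {m} {f g : Fin m → Bool} → (∀ j → f j ≡ g j) → any f ≡ any g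
any-cong {zero} _ = refl
any-cong {suc m} f≗g = cong₂ _∨_ (f≗g zero) (any-cong (λ j → f≗g (suc j)))

#≡any : ∀ {m} (f : Fin m → Bool) → (∀ a b → f a ≡ true → f b ≡ true → a ≡ b) →
        # f ≡ bool→ℕ (any f)
#≡any {zero} f _ = refl
#≡any {suc m} f at-most-one with f zero in f₀
... | true = cong suc (#-false (λ j → f (suc j)) rest-false)
  where
  rest-false : ∀ j → f (suc j) ≡ false
  rest-false j with f (suc j) in fj
  ... | false = refl
  ... | true with () ← at-most-one zero (suc j) f₀ fj
... | false = #≡any (λ j → f (suc j)) (λ a b fa fb → Fin.suc-injective (at-most-one (suc a) (suc b) fa fb))

∣X∣≡#lookup : ∀ {m} (X : Subset m) → ∣ X ∣ ≡ # (lookup X)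
∣X∣≡#lookup [] = refl
∣X∣≡#lookup (true ∷ X) = cong suc (∣X∣≡#lookup X)
∣X∣≡#lookup (false ∷ X) = ∣X∣≡#lookup X

∣tabulate∣ : ∀ {m} (f : Fin m → Bool) → ∣ tabulate f ∣ ≡ # f
∣tabulate∣ f = trans (∣X∣≡#lookup (tabulate f)) (#-cong (lookup∘tabulate f))

#-pick : ∀ {m} (f : Fin m → Bool) {k} → suc k ≤ # f →
         ∃ λ a → f a ≡ true × k ≤ # (λ j → f j ∧ not (j == a))
#-pick f {k} k<#f with #-pos⇒∃ f (≤-trans (s≤s z≤n) k<#f)
... | a , fa = a , fa , ℕ.s≤s⁻¹ (subst (suc k ≤_) (#-remove f fa) k<#f)

∧-not-==⁻ : ∀ {m} {x : Bool} {j a : Fin m} → (x ∧ not (j == a)) ≡ true → x ≡ true × j ≢ a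
∧-not-==⁻ {x = true} {j} {a} j≢a with j Fin.≟ a
... | no j≢a = refl , j≢a

#≥3⇒three : ∀ {m} (f : Fin m → Bool) → 3 ≤ # f →
  ∃ λ a → ∃ λ b → ∃ λ c → f a ≡ true × f b ≡ true × f c ≡ true × b ≢ a × c ≢ a × c ≢ b
#≥3⇒three f 3≤#f with #-pick f 3≤#f
... | a , fa , 2≤#f₁ with #-pick _ 2≤#f₁
... | b , f₁b , 1≤#f₂ with #-pick _ 1≤#f₂
... | c , f₂c , _ with ∧-not-==⁻ f₁b | ∧-not-==⁻ f₂c
... | fb , b≢a | f₁c , c≢b with ∧-not-==⁻ f₁c
... | fc , c≢a = a , b , c , fa , fb , fc , b≢a , c≢a , c≢b

-- Bracket matching inside the positions marked by t: scanning from right to left, a position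
-- of a opens a bracket and a position outside a closes the nearest open one, if any.
-- raise adds the leftmost unmatched position outside a; this is the classical injection
-- from j-subsets into (j+1)-subsets of a set of size at least 2j+1.
unmatchedIn : ∀ {m} → Vec Bool m → Vec Bool m → ℕ
unmatchedIn [] [] = 0
unmatchedIn (false ∷ t) (_ ∷ a) = unmatchedIn t a
unmatchedIn (true ∷ t) (true ∷ a) = suc (unmatchedIn t a)
unmatchedIn (true ∷ t) (false ∷ a) = ℕ.pred (unmatchedIn t a)

unmatchedOut : ∀ {m} → Vec Bool m → Vec Bool m → ℕ
unmatchedOut [] [] = 0
unmatchedOut (false ∷ t) (_ ∷ a) = unmatchedOut t a
unmatchedOut (true ∷ t) (true ∷ a) = unmatchedOut t a
unmatchedOut (true ∷ t) (false ∷ a) with unmatchedIn t a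
... | zero = suc (unmatchedOut t a)
... | suc _ = unmatchedOut t a

raise : ∀ {m} → Vec Bool m → Vec Bool m → Vec Bool m
raise [] [] = []
raise (false ∷ t) (x ∷ a) = x ∷ raise t a
raise (true ∷ t) (true ∷ a) = true ∷ raise t a
raise (true ∷ t) (false ∷ a) with unmatchedIn t a
... | zero = true ∷ a
... | suc _ = false ∷ raise t a

matching-balance : ∀ {m} (t a : Vec Bool m) →
  unmatchedOut t a + # (λ j → lookup t j ∧ lookup a j) ≡
  unmatchedIn t a + # (λ j → lookup t j ∧ not (lookup a j))
matching-balance [] [] = refl
matching-balance (false ∷ t) (_ ∷ a) = matching-balance t a
matching-balance (true ∷ t) (true ∷ a) =
  trans (+-suc (unmatchedOut t a) _) (cong suc (matching-balance t a))
matching-balance (true ∷ t) (false ∷ a) with unmatchedIn t a | matching-balance t a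
... | zero | balance = cong suc balance
... | suc k | balance = trans balance (sym (+-suc k _))

unmatchedOut-pos : ∀ {m} (t a : Vec Bool m) →
  # (λ j → lookup t j ∧ lookup a j) < # (λ j → lookup t j ∧ not (lookup a j)) →
  1 ≤ unmatchedOut t a
unmatchedOut-pos t a in<out with unmatchedOut t a | matching-balance t a
... | suc _ | _ = s≤s z≤n
... | zero | balance = ⊥-elim (<⇒≱ in<out (≤-trans (m≤n+m _ (unmatchedIn t a)) (≤-reflexive (sym balance))))

unmatchedIn-raise : ∀ {m} (t a : Vec Bool m) → 1 ≤ unmatchedOut t a →
                    unmatchedIn t (raise t a) ≡ suc (unmatchedIn t a)
unmatchedIn-raise [] [] ()
unmatchedIn-raise (false ∷ t) (_ ∷ a) p = unmatchedIn-raise t a p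
unmatchedIn-raise (true ∷ t) (true ∷ a) p = cong suc (unmatchedIn-raise t a p)
unmatchedIn-raise (true ∷ t) (false ∷ a) p with unmatchedIn t a in eq | unmatchedIn-raise t a
... | zero | _ rewrite eq = refl
... | suc k | ih rewrite ih p = refl

∣raise∣ : ∀ {m} (t a : Vec Bool m) → 1 ≤ unmatchedOut t a → ∣ raise t a ∣ ≡ suc ∣ a ∣
∣raise∣ [] [] ()
∣raise∣ (false ∷ t) (true ∷ a) p = cong suc (∣raise∣ t a p)
∣raise∣ (false ∷ t) (false ∷ a) p = ∣raise∣ t a p
∣raise∣ (true ∷ t) (true ∷ a) p = cong suc (∣raise∣ t a p)
∣raise∣ (true ∷ t) (false ∷ a) p with unmatchedIn t a | ∣raise∣ t a
... | zero | _ = refl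
... | suc _ | ih = ih p

raise-injective : ∀ {m} (t a b : Vec Bool m) → 1 ≤ unmatchedOut t a → 1 ≤ unmatchedOut t b →
                  raise t a ≡ raise t b → a ≡ b
raise-injective [] [] [] _ _ _ = refl
raise-injective (false ∷ t) (x ∷ a) (y ∷ b) p q e =
  cong₂ _∷_ (cong Vec.head e) (raise-injective t a b p q (cong Vec.tail e))
raise-injective (true ∷ t) (true ∷ a) (true ∷ b) p q e =
  cong (true ∷_) (raise-injective t a b p q (cong Vec.tail e))
raise-injective (true ∷ t) (true ∷ a) (false ∷ b) p q e with unmatchedIn t b in eq
... | suc _ with () ← e
... | zero with refl ← e with () ← trans (sym (unmatchedIn-raise t a p)) eq
raise-injective (true ∷ t) (false ∷ a) (true ∷ b) p q e with unmatchedIn t a in eq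
... | suc _ with () ← e
... | zero with refl ← e with () ← trans (sym (unmatchedIn-raise t b q)) eq
raise-injective (true ∷ t) (false ∷ a) (false ∷ b) p q e
  with unmatchedIn t a | unmatchedIn t b | raise-injective t a b
... | zero | zero | _ with refl ← e = refl
... | suc _ | suc _ | ih = cong (false ∷_) (ih p q (cong Vec.tail e))
raise-injective (true ∷ t) (false ∷ a) (false ∷ b) p q () | zero | suc _ | _
raise-injective (true ∷ t) (false ∷ a) (false ∷ b) p q () | suc _ | zero | _

raise⊆ : ∀ {m} (t a : Vec Bool m) j → lookup (raise t a) j ≡ true →
         lookup a j ≡ true ⊎ lookup t j ≡ true
raise⊆ (false ∷ t) (x ∷ a) zero e = inj₁ e
raise⊆ (false ∷ t) (x ∷ a) (suc j) e = raise⊆ t a j e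
raise⊆ (true ∷ t) (true ∷ a) zero e = inj₁ e
raise⊆ (true ∷ t) (true ∷ a) (suc j) e = raise⊆ t a j e
raise⊆ (true ∷ t) (false ∷ a) zero e = inj₂ refl
raise⊆ (true ∷ t) (false ∷ a) (suc j) e with unmatchedIn t a
... | zero = inj₁ e
... | suc _ = raise⊆ t a j e

raise-outside : ∀ {m} (t a : Vec Bool m) j → lookup t j ≡ false → lookup (raise t a) j ≡ lookup a j
raise-outside (false ∷ t) (x ∷ a) zero e = refl
raise-outside (false ∷ t) (x ∷ a) (suc j) e = raise-outside t a j e
raise-outside (true ∷ t) (true ∷ a) (suc j) e = raise-outside t a j e
raise-outside (true ∷ t) (false ∷ a) (suc j) e with unmatchedIn t a
... | zero = refl
... | suc _ = raise-outside t a j e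

-- Symmetric sequences

symmetric-from-≤ : (a : ℕ → ℕ) (d : ℕ) → (∀ k → a k ≤ a (d ∸ k)) → ∀ k → k ≤ d → a k ≡ a (d ∸ k)
symmetric-from-≤ a d a≤mirror k k≤d =
  ≤-antisym (a≤mirror k) (≤-trans (a≤mirror (d ∸ k)) (≤-reflexive (cong a (m∸[m∸n]≡n k≤d))))

halve : ∀ d → ∃ λ m → m + m ≤ d × d ≤ suc (m + m)
halve 0 = 0 , z≤n , z≤n
halve 1 = 0 , z≤n , s≤s z≤n
halve (suc (suc d)) with halve d
... | m , lo , hi = suc m , s≤s (subst (_≤ suc d) (sym (+-suc m m)) (s≤s lo))
                          , s≤s (subst (suc d ≤_) (cong suc (sym (+-suc m m))) (s≤s hi))

symmetric+rising⇒unimodal : (a : ℕ → ℕ) (d : ℕ) → (∀ k → k ≤ d → a k ≡ a (d ∸ k)) →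
  (∀ k → suc (k + k) ≤ d → a k ≤ a (suc k)) →
  ∃ λ m → m ≤ d × (∀ k → k < m → a k ≤ a (suc k)) × (∀ k → m ≤ k → k < d → a (suc k) ≤ a k)
symmetric+rising⇒unimodal a d symmetric rising with halve d
... | m , m+m≤d , d≤1+m+m = m , ≤-trans (m≤m+n m m) m+m≤d , increasing , decreasing
  where
  increasing : ∀ k → k < m → a k ≤ a (suc k)
  increasing k k<m = rising k (≤-trans (+-mono-≤ k<m (<⇒≤ k<m)) m+m≤d)
  decreasing : ∀ k → m ≤ k → k < d → a (suc k) ≤ a k
  decreasing k m≤k k<d = begin
    a (suc k)  ≡⟨ symmetric (suc k) k<d ⟩
    a j        ≤⟨ rising j 1+j+j≤d ⟩
    a (suc j)  ≡⟨ cong a (+-∸-assoc 1 k<d) ⟨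
    a (d ∸ k)  ≡⟨ symmetric k (<⇒≤ k<d) ⟨
    a k        ∎
    where
    open ≤-Reasoning
    j : ℕ
    j = d ∸ suc k
    j≤k : j ≤ k
    j≤k = m≤n+o⇒m∸n≤o d (suc k) (≤-trans d≤1+m+m (s≤s (+-mono-≤ m≤k m≤k)))
    1+j+j≤d : suc (j + j) ≤ d
    1+j+j≤d = begin
      suc (j + j)  ≤⟨ s≤s (+-monoʳ-≤ j j≤k) ⟩
      suc (j + k)  ≡⟨ +-suc j k ⟨
      j + suc k    ≡⟨ m∸n+n≡m k<d ⟩
      d            ∎

-- Independent sets

allᵇ⁻ : {A : Set} (p : A → Bool) (xs : List A) → T (allᵇ p xs) → ∀ {x} → x ∈ xs → T (p x)
allᵇ⁻ p (y ∷ xs) all-p (here refl) with p y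
... | true = _
allᵇ⁻ p (y ∷ xs) all-p (there x∈xs) with p y
... | true = allᵇ⁻ p xs all-p x∈xs

allᵇ⁺ : {A : Set} (p : A → Bool) (xs : List A) → (∀ x → T (p x)) → T (allᵇ p xs)
allᵇ⁺ p [] _ = _
allᵇ⁺ p (y ∷ xs) all-p with p y | all-p y
... | true | _ = allᵇ⁺ p xs all-p

lookup≡false⇒∉ : ∀ {m} {X : Subset m} {u} → lookup X u ≡ false → u ∉ X
lookup≡false⇒∉ Xu≡false u∈X with () ← trans (sym ([]=⇒lookup u∈X)) Xu≡false

module _ (G : Graph) where

  IsIndependent : (Fin (n G) → Bool) → Set
  IsIndependent X = ∀ a b → X a ≡ true → X b ≡ true → Adj G a b ≡ false

  Independent⇒IsIndependent : ∀ X → Independent G X → IsIndependent (lookup X)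
  Independent⇒IsIndependent X indep a b Xa Xb
    with allᵇ⁻ _ (allFin (n G)) (allᵇ⁻ _ (allFin (n G)) indep (∈-allFin a)) (∈-allFin b)
  ... | no-edge rewrite Xa | Xb with Adj G a b
  ... | false = refl

  IsIndependent⇒Independent : ∀ X → IsIndependent (lookup X) → Independent G X
  IsIndependent⇒Independent X indep =
    allᵇ⁺ _ (allFin (n G)) (λ a → allᵇ⁺ _ (allFin (n G)) (no-edge a))
    where
    no-edge : ∀ a b → T (not (lookup X a ∧ lookup X b ∧ Adj G a b))
    no-edge a b with lookup X a in Xa | lookup X b in Xb
    ... | false | _ = _
    ... | true | false = _
    ... | true | true rewrite indep a b Xa Xb = _

  ∣N∩X∣ : ∀ u X → ∣ N G u ∩ X ∣ ≡ # (λ j → Adj G u j ∧ lookup X j)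
  ∣N∩X∣ u X = trans (∣X∣≡#lookup (N G u ∩ X)) (#-cong (λ j →
    trans (lookup-zipWith _∧_ j (N G u) X) (cong (_∧ lookup X j) (lookup∘tabulate (Adj G u) j))))

  IsIndependent-tabulate : ∀ {X} → IsIndependent X → IsIndependent (lookup (tabulate X))
  IsIndependent-tabulate {X} indep a b Xa Xb =
    indep a b (trans (sym (lookup∘tabulate X a)) Xa) (trans (sym (lookup∘tabulate X b)) Xb)

  ⊆-independent : ∀ {X Y} → IsIndependent X → (∀ j → Y j ≡ true → X j ≡ true) → IsIndependent Y
  ⊆-independent indep Y⊆X a b Ya Yb = indep a b (Y⊆X a Ya) (Y⊆X b Yb)

  hasNeighbourIn : (Fin (n G) → Bool) → Fin (n G) → Bool
  hasNeighbourIn W j = any (λ w → W w ∧ Adj G w j)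

  hasNeighbourIn≡false⁻ : ∀ {W} a b → W a ≡ true → hasNeighbourIn W b ≡ false → Adj G a b ≡ false
  hasNeighbourIn≡false⁻ {W} a b Wa no-nbr with Adj G a b in ab
  ... | false = refl
  ... | true with () ← trans (sym (any⁺ (λ w → W w ∧ Adj G w b) (cong₂ _∧_ Wa ab))) no-nbr

  hasNeighbourIn≡false⁺ : ∀ W j → (∀ w → W w ≡ true → Adj G w j ≡ false) → hasNeighbourIn W j ≡ false
  hasNeighbourIn≡false⁺ W j no-edge = any-false _ no-edge∧
    where
    no-edge∧ : ∀ w → (W w ∧ Adj G w j) ≡ false
    no-edge∧ w with W w in Ww
    ... | true = no-edge w Ww
    ... | false = refl

  ∨-independent : ∀ {W Y} → IsIndependent W → IsIndependent Y →
                  (∀ j → Y j ≡ true → hasNeighbourIn W j ≡ false) →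
                  IsIndependent (λ j → W j ∨ Y j)
  ∨-independent {W} {Y} W-indep Y-indep Y∩N[W]=∅ a b WYa WYb
    with W a in Wa | W b in Wb
  ... | true | true = W-indep a b Wa Wb
  ... | true | false = hasNeighbourIn≡false⁻ a b Wa (Y∩N[W]=∅ b WYb)
  ... | false | true = trans (Graph.sym G a b) (hasNeighbourIn≡false⁻ b a Wb (Y∩N[W]=∅ a WYa))
  ... | false | false = Y-indep a b WYa WYb

  indepOfSize : ℕ → Subset (n G) → Bool
  indepOfSize k X = isIndep G X ∧ (∣ X ∣ ℕ.≡ᵇ k)

  indepOfSize⁺ : ∀ k X → IsIndependent (lookup X) → ∣ X ∣ ≡ k → T (indepOfSize k X)
  indepOfSize⁺ k X indep ∣X∣≡k with isIndep G X | IsIndependent⇒Independent X indep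
  ... | true | _ = ≡⇒≡ᵇ _ _ ∣X∣≡k

  indepOfSize⁻ : ∀ k X → T (indepOfSize k X) → IsIndependent (lookup X) × ∣ X ∣ ≡ k
  indepOfSize⁻ k X h with isIndep G X in indep
  ... | true = Independent⇒IsIndependent X (subst T (sym indep) _) , ≡ᵇ⇒≡ _ _ h

  ∣X∣≤α : ∀ X → IsIndependent (lookup X) → ∣ X ∣ ≤ α G
  ∣X∣≤α X indep = ≤-foldr-⊔ (∈-map⁺ ∣_∣ (∈-count⁺ (isIndep G) {X} (IsIndependent⇒Independent X indep)))
    where
    ≤-foldr-⊔ : ∀ {x xs} → x ∈ xs → x ≤ foldr _⊔_ 0 xs
    ≤-foldr-⊔ {xs = y ∷ _} (here refl) = m≤m⊔n y _
    ≤-foldr-⊔ {xs = y ∷ _} (there x∈xs) = m≤n⇒m≤o⊔n y (≤-foldr-⊔ x∈xs)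

  IsUniqueMaximum : Subset (n G) → Set
  IsUniqueMaximum S = IsIndependent (lookup S) × ∣ S ∣ ≡ α G ×
                      (∀ X → IsIndependent (lookup X) → ∣ X ∣ ≡ α G → X ≡ S)

  i[α]≡1⇒uniqueMaximum : i G (α G) ≡ 1 → ∃ IsUniqueMaximum
  i[α]≡1⇒uniqueMaximum i[α]≡1 with count≡1⇒∃ (indepOfSize (α G)) i[α]≡1
  ... | S , S-maximum with indepOfSize⁻ (α G) S S-maximum
  ... | S-indep , ∣S∣≡α = S , S-indep , ∣S∣≡α , unique
    where
    unique : ∀ X → IsIndependent (lookup X) → ∣ X ∣ ≡ α G → X ≡ S
    unique X X-indep ∣X∣≡α with ≡-dec _≟_ X S
    ... | yes X≡S = X≡S
    ... | no X≢S = ⊥-elim (<⇒≱ (s≤s (s≤s z≤n)) (begin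
      2                 ≤⟨ length≤count (indepOfSize (α G)) (S ∷ X ∷ [])
                             (((λ S≡X → X≢S (sym S≡X)) ∷ []) ∷ [] ∷ [])
                             (S-maximum ∷ indepOfSize⁺ (α G) X X-indep ∣X∣≡α ∷ []) ⟩
      i G (α G)         ≡⟨ i[α]≡1 ⟩
      1                 ∎))
      where open ≤-Reasoning

  module UniqueMaximum (S : Subset (n G)) (S-indep : IsIndependent (lookup S)) (∣S∣≡α : ∣ S ∣ ≡ α G)
    (S-unique : ∀ X → IsIndependent (lookup X) → ∣ X ∣ ≡ α G → X ≡ S) where

    s : Fin (n G) → Bool
    s = lookup S

    #s≡α : # s ≡ α G
    #s≡α = trans (sym (∣X∣≡#lookup S)) ∣S∣≡α

    -- exchange u is S − u when u ∈ S, and (S ∖ N(u)) + u when u ∉ S.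
    exchange : Fin (n G) → Fin (n G) → Bool
    exchange u j = (not (s u) ∧ (j == u)) ∨ (s j ∧ (not (j == u) ∧ not (Adj G u j)))

    Exchange : Fin (n G) → Subset (n G)
    Exchange u = tabulate (exchange u)

    exchange-independent : ∀ u → IsIndependent (exchange u)
    exchange-independent u = ∨-independent W-indep Y-indep Y∩N[W]≡∅
      where
      W-indep : IsIndependent (λ j → not (s u) ∧ (j == u))
      W-indep a b Wa Wb with ==⇒≡ a u (∧-conicalʳ (not (s u)) _ Wa) | ==⇒≡ b u (∧-conicalʳ (not (s u)) _ Wb)
      ... | refl | refl = irrefl G a
      Y-indep : IsIndependent (λ j → s j ∧ (not (j == u) ∧ not (Adj G u j)))
      Y-indep = ⊆-independent S-indep (λ j → ∧-conicalˡ (s j) _)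
      Y∩N[W]≡∅ : ∀ j → (s j ∧ (not (j == u) ∧ not (Adj G u j))) ≡ true →
                 hasNeighbourIn (λ w → not (s u) ∧ (w == u)) j ≡ false
      Y∩N[W]≡∅ j Yj = hasNeighbourIn≡false⁺ _ j no-edge
        where
        no-edge : ∀ w → (not (s u) ∧ (w == u)) ≡ true → Adj G w j ≡ false
        no-edge w Ww rewrite ==⇒≡ w u (∧-conicalʳ (not (s u)) _ Ww) =
          not≡true⇒≡false (∧-conicalʳ (not (j == u)) _ (∧-conicalʳ (s j) _ Yj))

    exchange-at : ∀ u j → lookup (Exchange u) j ≡ exchange u j
    exchange-at u = lookup∘tabulate (exchange u)

    Exchange-independent : ∀ u → IsIndependent (lookup (Exchange u))
    Exchange-independent u = IsIndependent-tabulate (exchange-independent u)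

    exchange-self : ∀ u → exchange u u ≡ not (s u)
    exchange-self u rewrite ==-refl u with s u
    ... | true = refl
    ... | false = refl

    exchange-outside : ∀ u j → exchange u j ≡ true → s j ≡ false → j ≡ u
    exchange-outside u j e sj rewrite sj with s u
    ... | false = ==⇒≡ j u (trans (sym (∨-identityʳ (j == u))) e)

    exchange-inside : ∀ u j → j ≢ u → s u ≡ true → s j ≡ true → exchange u j ≡ true
    exchange-inside u j j≢u su sj rewrite su | sj | ≢⇒==false j≢u | S-indep u j su sj = refl

    ∣Exchange∣-inside : ∀ u → s u ≡ true → suc ∣ Exchange u ∣ ≡ α G
    ∣Exchange∣-inside u su = begin
      suc ∣ Exchange u ∣                  ≡⟨ cong suc (∣tabulate∣ (exchange u)) ⟩
      suc (# exchange u)                  ≡⟨ cong suc (#-cong S-minus-u) ⟩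
      suc (# (λ j → s j ∧ not (j == u)))  ≡⟨ #-remove s su ⟨
      # s                                 ≡⟨ #s≡α ⟩
      α G                                 ∎
      where
      open ≡-Reasoning
      S-minus-u : ∀ j → exchange u j ≡ (s j ∧ not (j == u))
      S-minus-u j rewrite su with s j in sj
      ... | false = refl
      ... | true rewrite S-indep u j su sj with j == u
      ... | true = refl
      ... | false = refl

    ∣Exchange∣-outside : ∀ u → s u ≡ false →
                         ∣ Exchange u ∣ + # (λ j → Adj G u j ∧ s j) ≡ suc (α G)
    ∣Exchange∣-outside u su = begin
      ∣ Exchange u ∣ + # (λ j → Adj G u j ∧ s j)
        ≡⟨ cong₂ _+_ (trans (∣tabulate∣ (exchange u)) (#-cong u+S∖N[u]))
                     (#-cong (λ j → ∧-comm (Adj G u j) (s j))) ⟩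
      # (λ j → (j == u) ∨ (s j ∧ not (Adj G u j))) + # (λ j → s j ∧ Adj G u j)
        ≡⟨ cong (_+ # (λ j → s j ∧ Adj G u j)) (#-∨-disjoint (_== u) _ u∉S) ⟩
      # (_== u) + # (λ j → s j ∧ not (Adj G u j)) + # (λ j → s j ∧ Adj G u j)
        ≡⟨ cong (λ c → c + # (λ j → s j ∧ not (Adj G u j)) + # (λ j → s j ∧ Adj G u j)) (#-== u) ⟩
      suc (# (λ j → s j ∧ not (Adj G u j)) + # (λ j → s j ∧ Adj G u j))
        ≡⟨ cong suc (+-comm _ (# (λ j → s j ∧ Adj G u j))) ⟩
      suc (# (λ j → s j ∧ Adj G u j) + # (λ j → s j ∧ not (Adj G u j)))
        ≡⟨ cong suc (#-split s (Adj G u)) ⟨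
      suc (# s)
        ≡⟨ cong suc #s≡α ⟩
      suc (α G) ∎
      where
      open ≡-Reasoning
      u+S∖N[u] : ∀ j → exchange u j ≡ ((j == u) ∨ (s j ∧ not (Adj G u j)))
      u+S∖N[u] j with j Fin.≟ u
      ... | yes refl rewrite su = refl
      ... | no _ rewrite su = refl
      u∉S : ∀ j → (j == u) ≡ true → (s j ∧ not (Adj G u j)) ≡ false
      u∉S j j==u rewrite ==⇒≡ j u j==u | su = refl

    Exchange-injective : ∀ {u v} → Exchange u ≡ Exchange v → u ≡ v
    Exchange-injective {u} {v} e = injective (s u) (s v) refl refl
      where
      same : ∀ j → exchange u j ≡ exchange v j
      same j = trans (sym (exchange-at u j)) (trans (cong (λ X → lookup X j) e) (exchange-at v j))
      injective : ∀ x y → s u ≡ x → s v ≡ y → u ≡ v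
      injective false _ su _ =
        exchange-outside v u (trans (sym (same u)) (trans (exchange-self u) (cong not su))) su
      injective true false su sv =
        sym (exchange-outside u v (trans (same v) (trans (exchange-self v) (cong not sv))) sv)
      injective true true su sv with u Fin.≟ v
      ... | yes u≡v = u≡v
      ... | no u≢v with () ← trans (sym (trans (same u) (exchange-inside v u u≢v sv su)))
                                  (trans (exchange-self u) (cong not su))

    ∈∖S⇒≢S : ∀ X {v} → lookup X v ≡ true → s v ≡ false → X ≢ S
    ∈∖S⇒≢S X Xv sv refl with () ← trans (sym Xv) sv

    claw-free⇒two-neighbours : ClawFree G → ∀ u → s u ≡ false → # (λ j → Adj G u j ∧ s j) ≡ 2
    claw-free⇒two-neighbours claw-free u su = by-cases _ refl
      where
      c : ℕ
      c = # (λ j → Adj G u j ∧ s j)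
      u∈Exchange : lookup (Exchange u) u ≡ true
      u∈Exchange = trans (exchange-at u u) (trans (exchange-self u) (cong not su))
      by-cases : ∀ k → c ≡ k → k ≡ 2
      by-cases 0 c≡0 = ⊥-elim (<⇒≱ (n<1+n (α G)) (begin
        suc (α G)             ≡⟨ ∣Exchange∣-outside u su ⟨
        ∣ Exchange u ∣ + c    ≡⟨ cong (∣ Exchange u ∣ +_) c≡0 ⟩
        ∣ Exchange u ∣ + 0    ≡⟨ +-identityʳ _ ⟩
        ∣ Exchange u ∣        ≤⟨ ∣X∣≤α (Exchange u) (Exchange-independent u) ⟩
        α G                   ∎))
        where open ≤-Reasoning
      by-cases 1 c≡1 = ⊥-elim (∈∖S⇒≢S (Exchange u) u∈Exchange su
        (S-unique (Exchange u) (Exchange-independent u)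
          (suc-injective (trans (+-comm 1 _) (trans (cong (∣ Exchange u ∣ +_) (sym c≡1))
                                                    (∣Exchange∣-outside u su))))))
      by-cases 2 _ = refl
      by-cases (suc (suc (suc k))) c≡3+k
        with #≥3⇒three (λ j → Adj G u j ∧ s j) (≤-trans (m≤m+n 3 k) (≤-reflexive (sym c≡3+k)))
      ... | a , b , d , ua , ub , ud , b≢a , d≢a , d≢b =
        ⊥-elim (claw-free u a b d (adj ua) (adj ub) (adj ud)
                  (≢-sym b≢a) (≢-sym d≢a) (≢-sym d≢b)
                  (S-indep a b (inS ua) (inS ub)) (S-indep a d (inS ua) (inS ud))
                  (S-indep b d (inS ub) (inS ud)))
        where
        adj : ∀ {j} → (Adj G u j ∧ s j) ≡ true → Adj G u j ≡ true
        adj {j} = ∧-conicalˡ (Adj G u j) (s j)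
        inS : ∀ {j} → (Adj G u j ∧ s j) ≡ true → s j ≡ true
        inS {j} = ∧-conicalʳ (Adj G u j) (s j)

    pair : Fin (n G) → Fin (n G) → Fin (n G) → Bool
    pair v w j = (j == v) ∨ (j == w)

    awayFrom : Fin (n G) → Fin (n G) → Fin (n G) → Bool
    awayFrom v w j = s j ∧ not (Adj G v j ∨ Adj G w j)

    PairExtension : Fin (n G) → Fin (n G) → Subset (n G)
    PairExtension v w = tabulate (λ j → pair v w j ∨ awayFrom v w j)

    pair⁻ : ∀ v w j → pair v w j ≡ true → j ≡ v ⊎ j ≡ w
    pair⁻ v w j e with j Fin.≟ v
    ... | yes j≡v = inj₁ j≡v
    ... | no _ = inj₂ (==⇒≡ j w e)

    PairExtension-independent : ∀ v w → Adj G v w ≡ false → IsIndependent (lookup (PairExtension v w))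
    PairExtension-independent v w vw = IsIndependent-tabulate
      (∨-independent pair-indep (⊆-independent S-indep (λ j → ∧-conicalˡ (s j) _)) away∩N[pair]≡∅)
      where
      pair-indep : IsIndependent (pair v w)
      pair-indep a b pa pb with pair⁻ v w a pa | pair⁻ v w b pb
      ... | inj₁ refl | inj₁ refl = irrefl G v
      ... | inj₁ refl | inj₂ refl = vw
      ... | inj₂ refl | inj₁ refl = trans (Graph.sym G w v) vw
      ... | inj₂ refl | inj₂ refl = irrefl G w
      away∩N[pair]≡∅ : ∀ j → awayFrom v w j ≡ true → hasNeighbourIn (pair v w) j ≡ false
      away∩N[pair]≡∅ j away = hasNeighbourIn≡false⁺ (pair v w) j no-edge
        where
        no-edge : ∀ z → pair v w z ≡ true → Adj G z j ≡ false
        no-edge z pz with pair⁻ v w z pz | not≡true⇒≡false (∧-conicalʳ (s j) _ away)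
        ... | inj₁ refl | ¬vj∨wj = ∨-conicalˡ (Adj G v j) _ ¬vj∨wj
        ... | inj₂ refl | ¬vj∨wj = ∨-conicalʳ _ (Adj G w j) ¬vj∨wj

    v∈PairExtension : ∀ v w → lookup (PairExtension v w) v ≡ true
    v∈PairExtension v w rewrite lookup∘tabulate (λ j → pair v w j ∨ awayFrom v w j) v | ==-refl v = refl

    w∈PairExtension : ∀ v w → lookup (PairExtension v w) w ≡ true
    w∈PairExtension v w rewrite lookup∘tabulate (λ j → pair v w j ∨ awayFrom v w j) w | ==-refl w
      with w == v
    ... | true = refl
    ... | false = refl

    ∣PairExtension∣ : ∀ {v w} → s v ≡ false → s w ≡ false → v ≢ w →
                      ∣ PairExtension v w ∣ ≡ 2 + # (awayFrom v w)
    ∣PairExtension∣ {v} {w} sv sw v≢w = begin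
      ∣ PairExtension v w ∣                     ≡⟨ ∣tabulate∣ (λ j → pair v w j ∨ awayFrom v w j) ⟩
      # (λ j → pair v w j ∨ awayFrom v w j)     ≡⟨ #-∨-disjoint (pair v w) (awayFrom v w) pair∉S ⟩
      # (pair v w) + # (awayFrom v w)           ≡⟨ cong (_+ # (awayFrom v w)) #pair ⟩
      2 + # (awayFrom v w)                      ∎
      where
      open ≡-Reasoning
      pair∉S : ∀ j → pair v w j ≡ true → awayFrom v w j ≡ false
      pair∉S j pj with pair⁻ v w j pj
      ... | inj₁ refl rewrite sv = refl
      ... | inj₂ refl rewrite sw = refl
      #pair : # (pair v w) ≡ 2
      #pair = trans (#-∨-disjoint (_== v) (_== w) distinct) (cong₂ _+_ (#-== v) (#-== w))
        where
        distinct : ∀ j → (j == v) ≡ true → (j == w) ≡ false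
        distinct j j==v rewrite ==⇒≡ j v j==v = ≢⇒==false v≢w

    α≡#S∩N+#awayFrom : ∀ v w → α G ≡ # (λ j → s j ∧ (Adj G v j ∨ Adj G w j)) + # (awayFrom v w)
    α≡#S∩N+#awayFrom v w = trans (sym #s≡α) (#-split s (λ j → Adj G v j ∨ Adj G w j))

    module TwoNeighbours (two : ∀ u → s u ≡ false → # (λ j → Adj G u j ∧ s j) ≡ 2)
                         (i[α-1]≡∣V∣ : PrevCountIsV G) where

      open DecMembership (≡-dec {n = n G} _≟_) using (_∈?_)

      ∣Exchange∣ : ∀ u → suc ∣ Exchange u ∣ ≡ α G
      ∣Exchange∣ u = by-membership (s u) refl
        where
        open ≡-Reasoning
        by-membership : ∀ b → s u ≡ b → suc ∣ Exchange u ∣ ≡ α G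
        by-membership true su = ∣Exchange∣-inside u su
        by-membership false su = suc-injective (begin
          suc (suc ∣ Exchange u ∣)                   ≡⟨ +-comm 2 ∣ Exchange u ∣ ⟩
          ∣ Exchange u ∣ + 2                         ≡⟨ cong (∣ Exchange u ∣ +_) (two u su) ⟨
          ∣ Exchange u ∣ + # (λ j → Adj G u j ∧ s j) ≡⟨ ∣Exchange∣-outside u su ⟩
          suc (α G)                                 ∎)

      -- The exchange sets are |V| distinct independent (α−1)-sets, so by i_{α−1} = |V| there
      -- are no others.
      near-maximum⇒Exchange : ∀ X → IsIndependent (lookup X) → suc ∣ X ∣ ≡ α G →
                              ∃ λ u → X ≡ Exchange u
      near-maximum⇒Exchange X X-indep 1+∣X∣≡α with X ∈? map Exchange (allFin (n G))
      ... | yes X∈Exchanges with ∈-map⁻ Exchange X∈Exchanges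
      ...   | u , _ , X≡Exchange-u = u , X≡Exchange-u
      near-maximum⇒Exchange X X-indep 1+∣X∣≡α | no X∉Exchanges =
        ⊥-elim (<⇒≱ (n<1+n (n G)) (begin
          suc (n G)
            ≡⟨ cong suc (trans (length-map Exchange (allFin (n G))) (length-tabulate _)) ⟨
          suc (length (map Exchange (allFin (n G))))
            ≤⟨ length≤count (indepOfSize ∣ X ∣) _ unique sized ⟩
          i G ∣ X ∣
            ≡⟨ i[α-1]≡∣V∣ ∣ X ∣ 1+∣X∣≡α ⟩
          n G ∎))
        where
        open ≤-Reasoning
        unique : Unique (X ∷ map Exchange (allFin (n G)))
        unique = ¬Any⇒All¬ _ X∉Exchanges ∷ Unique.map⁺ Exchange-injective (Unique.allFin⁺ (n G))
        sized : All (T ∘′ indepOfSize ∣ X ∣) (X ∷ map Exchange (allFin (n G)))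
        sized = indepOfSize⁺ ∣ X ∣ X X-indep refl
              ∷ map⁺ (tabulate⁺ λ u → indepOfSize⁺ ∣ X ∣ (Exchange u) (Exchange-independent u)
                            (suc-injective (trans (∣Exchange∣ u) (sym 1+∣X∣≡α))))

      #S∩N+#common≡4 : ∀ {v w} → s v ≡ false → s w ≡ false →
        # (λ j → s j ∧ (Adj G v j ∨ Adj G w j)) + # (λ j → (Adj G v j ∧ s j) ∧ (Adj G w j ∧ s j)) ≡ 4
      #S∩N+#common≡4 {v} {w} sv sw = begin
        # (λ j → s j ∧ (Adj G v j ∨ Adj G w j)) + # (λ j → (Adj G v j ∧ s j) ∧ (Adj G w j ∧ s j))
          ≡⟨ cong (_+ # (λ j → (Adj G v j ∧ s j) ∧ (Adj G w j ∧ s j))) (#-cong distrib) ⟩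
        # (λ j → (Adj G v j ∧ s j) ∨ (Adj G w j ∧ s j)) + # (λ j → (Adj G v j ∧ s j) ∧ (Adj G w j ∧ s j))
          ≡⟨ #-∨+#-∧ (λ j → Adj G v j ∧ s j) (λ j → Adj G w j ∧ s j) ⟩
        # (λ j → Adj G v j ∧ s j) + # (λ j → Adj G w j ∧ s j)
          ≡⟨ cong₂ _+_ (two v sv) (two w sw) ⟩
        4 ∎
        where
        open ≡-Reasoning
        distrib : ∀ j → (s j ∧ (Adj G v j ∨ Adj G w j)) ≡ ((Adj G v j ∧ s j) ∨ (Adj G w j ∧ s j))
        distrib j = trans (∧-distribˡ-∨ (s j) (Adj G v j) (Adj G w j))
                          (cong₂ _∨_ (∧-comm (s j) (Adj G v j)) (∧-comm (s j) (Adj G w j)))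

      -- PairExtension v w has α − 2 + c elements, c the number of common neighbours of v, w in S:
      -- for c = 2 it is a second maximum set, for c = 1 an (α−1)-set that is no exchange set.
      no-common-neighbour : ∀ {v w x} → s v ≡ false → s w ≡ false → v ≢ w → Adj G v w ≡ false →
                            s x ≡ true → Adj G v x ≡ true → Adj G w x ≡ true → ⊥
      no-common-neighbour {v} {w} {x} sv sw v≢w vw sx vx wx = by-common common refl common-pos common≤2
        where
        open ≡-Reasoning
        P : Subset (n G)
        P = PairExtension v w
        S∩N common : ℕ
        S∩N = # (λ j → s j ∧ (Adj G v j ∨ Adj G w j))
        common = # (λ j → (Adj G v j ∧ s j) ∧ (Adj G w j ∧ s j))
        common-pos : 1 ≤ common
        common-pos = #-pos _ {x} (cong₂ _∧_ (cong₂ _∧_ vx sx) (cong₂ _∧_ wx sx))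
        common≤2 : common ≤ 2
        common≤2 = ≤-trans (#-mono (λ j → ∧-conicalˡ (Adj G v j ∧ s j) _)) (≤-reflexive (two v sv))
        ∣P∣+S∩N≡α+2 : ∣ P ∣ + S∩N ≡ α G + 2
        ∣P∣+S∩N≡α+2 = begin
          ∣ P ∣ + S∩N                   ≡⟨ cong (_+ S∩N) (∣PairExtension∣ sv sw v≢w) ⟩
          2 + # (awayFrom v w) + S∩N    ≡⟨ rearrange (# (awayFrom v w)) S∩N ⟩
          S∩N + # (awayFrom v w) + 2    ≡⟨ cong (_+ 2) (α≡#S∩N+#awayFrom v w) ⟨
          α G + 2                       ∎
          where
          rearrange : ∀ r m → 2 + r + m ≡ m + r + 2
          rearrange = solve-∀
        S∩N+c≡4 : ∀ {c} → common ≡ c → S∩N + c ≡ 4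
        S∩N+c≡4 refl = #S∩N+#common≡4 sv sw
        ≡u : ∀ {u} → P ≡ Exchange u → ∀ j → lookup P j ≡ true → s j ≡ false → j ≡ u
        ≡u {u} P≡Exchange-u j Pj sj =
          exchange-outside u j
            (trans (sym (exchange-at u j)) (subst (λ X → lookup X j ≡ true) P≡Exchange-u Pj)) sj
        by-common : ∀ c → common ≡ c → 1 ≤ c → c ≤ 2 → ⊥
        by-common 1 common≡1 _ _ with near-maximum⇒Exchange P (PairExtension-independent v w vw)
          (+-cancelʳ-≡ 2 (suc ∣ P ∣) (α G) (begin
            suc ∣ P ∣ + 2   ≡⟨ +-suc ∣ P ∣ 2 ⟨
            ∣ P ∣ + 3       ≡⟨ cong (∣ P ∣ +_) (+-cancelʳ-≡ 1 S∩N 3 (S∩N+c≡4 common≡1)) ⟨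
            ∣ P ∣ + S∩N     ≡⟨ ∣P∣+S∩N≡α+2 ⟩
            α G + 2         ∎))
        ... | u , P≡Exchange-u =
          v≢w (trans (≡u P≡Exchange-u v (v∈PairExtension v w) sv)
                     (sym (≡u P≡Exchange-u w (w∈PairExtension v w) sw)))
        by-common 2 common≡2 _ _ =
          ∈∖S⇒≢S P (v∈PairExtension v w) sv (S-unique P (PairExtension-independent v w vw)
            (+-cancelʳ-≡ 2 ∣ P ∣ (α G) (begin
              ∣ P ∣ + 2       ≡⟨ cong (∣ P ∣ +_) (+-cancelʳ-≡ 2 S∩N 2 (S∩N+c≡4 common≡2)) ⟨
              ∣ P ∣ + S∩N     ≡⟨ ∣P∣+S∩N≡α+2 ⟩
              α G + 2         ∎)))
        by-common (suc (suc (suc _))) _ _ (s≤s (s≤s ()))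

      -- outside Z and free Z are W = Z ∖ S and T = S ∖ N(W), so that Z = W ∪ (Z ∩ T).
      outside : Subset (n G) → Fin (n G) → Bool
      outside Z j = lookup Z j ∧ not (s j)

      free : Subset (n G) → Fin (n G) → Bool
      free Z j = s j ∧ not (hasNeighbourIn (outside Z) j)

      outside⊆ : ∀ Z j → outside Z j ≡ true → lookup Z j ≡ true × s j ≡ false
      outside⊆ Z j e = ∧-conicalˡ (lookup Z j) _ e , not≡true⇒≡false (∧-conicalʳ (lookup Z j) _ e)

      free-cong : ∀ X Z → (∀ j → outside X j ≡ outside Z j) → ∀ j → free X j ≡ free Z j
      free-cong X Z same j = cong (λ b → s j ∧ not b) (any-cong (λ w → cong (_∧ Adj G w j) (same w)))

      outside-independent : ∀ Z → IsIndependent (lookup Z) → IsIndependent (outside Z)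
      outside-independent Z Z-indep = ⊆-independent Z-indep (λ j e → proj₁ (outside⊆ Z j e))

      independent-if : ∀ X → IsIndependent (outside X) →
                       (∀ j → lookup X j ≡ true → s j ≡ true → free X j ≡ true) → IsIndependent (lookup X)
      independent-if X W-indep X∩S⊆free =
        ⊆-independent (∨-independent W-indep (⊆-independent S-indep inS) no-edge) split
        where
        inS : ∀ j → (lookup X j ∧ s j) ≡ true → s j ≡ true
        inS j = ∧-conicalʳ (lookup X j) (s j)
        no-edge : ∀ j → (lookup X j ∧ s j) ≡ true → hasNeighbourIn (outside X) j ≡ false
        no-edge j e = not≡true⇒≡false (∧-conicalʳ (s j) _
                        (X∩S⊆free j (∧-conicalˡ (lookup X j) (s j) e) (inS j e)))
        split : ∀ j → lookup X j ≡ true → (outside X j ∨ (lookup X j ∧ s j)) ≡ true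
        split j Xj rewrite Xj with s j
        ... | true = refl
        ... | false = refl

      Z∩S⊆free : ∀ Z → IsIndependent (lookup Z) → ∀ j → lookup Z j ≡ true → s j ≡ true → free Z j ≡ true
      Z∩S⊆free Z Z-indep j Zj sj rewrite sj =
        cong not (hasNeighbourIn≡false⁺ (outside Z) j (λ w e → Z-indep w j (proj₁ (outside⊆ Z w e)) Zj))

      #S∩N[outside] : ∀ Z → IsIndependent (lookup Z) →
                      # (λ j → s j ∧ hasNeighbourIn (outside Z) j) ≡ 2 * # (outside Z)
      #S∩N[outside] Z Z-indep = begin
        # (λ j → s j ∧ hasNeighbourIn W j)
          ≡⟨ sum-cong-≗ per-vertex-of-S ⟩
        sum (λ j → # (λ w → s j ∧ (W w ∧ Adj G w j)))
          ≡⟨ ∑-comm (λ j w → bool→ℕ (s j ∧ (W w ∧ Adj G w j))) ⟩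
        sum (λ w → # (λ j → s j ∧ (W w ∧ Adj G w j)))
          ≡⟨ sum-cong-≗ per-vertex-of-W ⟩
        sum (λ w → 2 * bool→ℕ (W w))
          ≡⟨ *-distribˡ-sum 2 (λ w → bool→ℕ (W w)) ⟨
        2 * # W ∎
        where
        open ≡-Reasoning
        W : Fin (n G) → Bool
        W = outside Z
        -- A vertex of S has at most one neighbour in W, by no-common-neighbour.
        per-vertex-of-S : ∀ j → bool→ℕ (s j ∧ hasNeighbourIn W j) ≡ # (λ w → s j ∧ (W w ∧ Adj G w j))
        per-vertex-of-S j with s j in sj
        ... | false = sym (#-false (λ w → false ∧ (W w ∧ Adj G w j)) (λ _ → refl))
        ... | true = sym (#≡any (λ w → W w ∧ Adj G w j) at-most-one)
          where
          at-most-one : ∀ a b → (W a ∧ Adj G a j) ≡ true → (W b ∧ Adj G b j) ≡ true → a ≡ b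
          at-most-one a b e f
            with a Fin.≟ b | outside⊆ Z a (∧-conicalˡ (W a) _ e) | outside⊆ Z b (∧-conicalˡ (W b) _ f)
          ... | yes a≡b | _ | _ = a≡b
          ... | no a≢b | Za , sa | Zb , sb =
            ⊥-elim (no-common-neighbour sa sb a≢b (Z-indep a b Za Zb) sj
                      (∧-conicalʳ (W a) _ e) (∧-conicalʳ (W b) _ f))
        per-vertex-of-W : ∀ w → # (λ j → s j ∧ (W w ∧ Adj G w j)) ≡ 2 * bool→ℕ (W w)
        per-vertex-of-W w with W w in Ww
        ... | false = #-false _ (λ j → ∧-zeroʳ (s j))
        ... | true = trans (#-cong (λ j → ∧-comm (s j) (Adj G w j))) (two w (proj₂ (outside⊆ Z w Ww)))

      α≡2∣outside∣+∣free∣ : ∀ Z → IsIndependent (lookup Z) → α G ≡ 2 * # (outside Z) + # (free Z)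
      α≡2∣outside∣+∣free∣ Z Z-indep = begin
        α G
          ≡⟨ #s≡α ⟨
        # s
          ≡⟨ #-split s (hasNeighbourIn (outside Z)) ⟩
        # (λ j → s j ∧ hasNeighbourIn (outside Z) j) + # (free Z)
          ≡⟨ cong (_+ # (free Z)) (#S∩N[outside] Z Z-indep) ⟩
        2 * # (outside Z) + # (free Z) ∎
        where open ≡-Reasoning

      ∣Z∣≡∣outside∣+∣free∩Z∣ : ∀ Z → IsIndependent (lookup Z) →
                              ∣ Z ∣ ≡ # (outside Z) + # (λ j → free Z j ∧ lookup Z j)
      ∣Z∣≡∣outside∣+∣free∩Z∣ Z Z-indep =
        trans (∣X∣≡#lookup Z) (trans (#-cong split) (#-∨-disjoint (outside Z) _ disjoint))
        where
        split : ∀ j → lookup Z j ≡ (outside Z j ∨ (free Z j ∧ lookup Z j))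
        split j = by-cases (lookup Z j) (s j) _
          (λ Zj sj → ∧-conicalʳ (s j) _ (Z∩S⊆free Z Z-indep j Zj sj))
          where
          by-cases : ∀ z x y → (z ≡ true → x ≡ true → y ≡ true) → z ≡ ((z ∧ not x) ∨ ((x ∧ y) ∧ z))
          by-cases false false _ _ = refl
          by-cases false true y _ = sym (∧-zeroʳ y)
          by-cases true false _ _ = refl
          by-cases true true y h rewrite h refl refl = refl
        disjoint : ∀ j → outside Z j ≡ true → (free Z j ∧ lookup Z j) ≡ false
        disjoint j e rewrite proj₂ (outside⊆ Z j e) = refl

      complement : Subset (n G) → Subset (n G)
      complement Z = tabulate (λ j → outside Z j ∨ (free Z j ∧ not (lookup Z j)))

      complement-at : ∀ Z j → lookup (complement Z) j ≡ (outside Z j ∨ (free Z j ∧ not (lookup Z j)))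
      complement-at Z = lookup∘tabulate (λ j → outside Z j ∨ (free Z j ∧ not (lookup Z j)))

      outside-complement : ∀ Z j → outside (complement Z) j ≡ outside Z j
      outside-complement Z j rewrite complement-at Z j = by-cases (lookup Z j) (s j) _
        where
        by-cases : ∀ z x y → (((z ∧ not x) ∨ ((x ∧ y) ∧ not z)) ∧ not x) ≡ (z ∧ not x)
        by-cases false false _ = refl
        by-cases false true false = refl
        by-cases false true true = refl
        by-cases true false _ = refl
        by-cases true true false = refl
        by-cases true true true = refl

      free-complement : ∀ Z j → free (complement Z) j ≡ free Z j
      free-complement Z = free-cong (complement Z) Z (outside-complement Z)

      complement-independent : ∀ Z → IsIndependent (lookup Z) → IsIndependent (lookup (complement Z))
      complement-independent Z Z-indep = independent-if (complement Z) W-indep S-part⊆free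
        where
        W-indep : IsIndependent (outside (complement Z))
        W-indep = ⊆-independent (outside-independent Z Z-indep)
                    (λ j e → trans (sym (outside-complement Z j)) e)
        S-part⊆free : ∀ j → lookup (complement Z) j ≡ true → s j ≡ true → free (complement Z) j ≡ true
        S-part⊆free j e sj = trans (free-complement Z j) (∧-conicalˡ (free Z j) _
          (subst (λ x → (x ∨ (free Z j ∧ not (lookup Z j))) ≡ true) outside≡false
                 (trans (sym (complement-at Z j)) e)))
          where
          outside≡false : outside Z j ≡ false
          outside≡false = trans (cong (λ x → lookup Z j ∧ not x) sj) (∧-zeroʳ (lookup Z j))

      ∣Z∣+∣complement∣≡α : ∀ Z → IsIndependent (lookup Z) → ∣ Z ∣ + ∣ complement Z ∣ ≡ α G
      ∣Z∣+∣complement∣≡α Z Z-indep = begin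
        ∣ Z ∣ + ∣ complement Z ∣
          ≡⟨ cong₂ _+_ (∣Z∣≡∣outside∣+∣free∩Z∣ Z Z-indep) ∣complement∣ ⟩
        (# W + # (λ j → free Z j ∧ lookup Z j)) + (# W + # (λ j → free Z j ∧ not (lookup Z j)))
          ≡⟨ +-double (# W) _ _ ⟩
        2 * # W + (# (λ j → free Z j ∧ lookup Z j) + # (λ j → free Z j ∧ not (lookup Z j)))
          ≡⟨ cong (2 * # W +_) (#-split (free Z) (lookup Z)) ⟨
        2 * # W + # (free Z)
          ≡⟨ α≡2∣outside∣+∣free∣ Z Z-indep ⟨
        α G ∎
        where
        open ≡-Reasoning
        W : Fin (n G) → Bool
        W = outside Z
        ∣complement∣ : ∣ complement Z ∣ ≡ # W + # (λ j → free Z j ∧ not (lookup Z j))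
        ∣complement∣ = trans (∣tabulate∣ (λ j → W j ∨ (free Z j ∧ not (lookup Z j))))
                             (#-∨-disjoint W _ disjoint)
          where
          disjoint : ∀ j → W j ≡ true → (free Z j ∧ not (lookup Z j)) ≡ false
          disjoint j e rewrite proj₂ (outside⊆ Z j e) = refl
        +-double : ∀ w a b → (w + a) + (w + b) ≡ 2 * w + (a + b)
        +-double = solve-∀

      complement-involutive : ∀ Z → IsIndependent (lookup Z) → complement (complement Z) ≡ Z
      complement-involutive Z Z-indep = trans (tabulate-cong pointwise) (tabulate∘lookup Z)
        where
        pointwise : ∀ j →
          (outside (complement Z) j ∨ (free (complement Z) j ∧ not (lookup (complement Z) j))) ≡ lookup Z j
        pointwise j rewrite outside-complement Z j | free-complement Z j | complement-at Z j =
          by-cases (lookup Z j) (s j) _ (λ Zj sj → ∧-conicalʳ (s j) _ (Z∩S⊆free Z Z-indep j Zj sj))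
          where
          by-cases : ∀ z x y → (z ≡ true → x ≡ true → y ≡ true) →
                     ((z ∧ not x) ∨ ((x ∧ y) ∧ not ((z ∧ not x) ∨ ((x ∧ y) ∧ not z)))) ≡ z
          by-cases false false _ _ = refl
          by-cases false true false _ = refl
          by-cases false true true _ = refl
          by-cases true false _ _ = refl
          by-cases true true y h rewrite h refl refl = refl

      i≤i[α∸] : ∀ k → i G k ≤ i G (α G ∸ k)
      i≤i[α∸] k = count-≤ (indepOfSize k) (indepOfSize (α G ∸ k)) complement sized injective
        where
        sized : ∀ Z → T (indepOfSize k Z) → T (indepOfSize (α G ∸ k) (complement Z))
        sized Z h with indepOfSize⁻ k Z h
        ... | Z-indep , refl = indepOfSize⁺ _ (complement Z) (complement-independent Z Z-indep)
          (trans (sym (m+n∸m≡n ∣ Z ∣ _)) (cong (_∸ ∣ Z ∣) (∣Z∣+∣complement∣≡α Z Z-indep)))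
        injective : ∀ X Y → T (indepOfSize k X) → T (indepOfSize k Y) → complement X ≡ complement Y → X ≡ Y
        injective X Y hX hY e = begin
          X                           ≡⟨ complement-involutive X (proj₁ (indepOfSize⁻ k X hX)) ⟨
          complement (complement X)   ≡⟨ cong complement e ⟩
          complement (complement Y)   ≡⟨ complement-involutive Y (proj₁ (indepOfSize⁻ k Y hY)) ⟩
          Y                           ∎
          where open ≡-Reasoning

      raiseFree : Subset (n G) → Subset (n G)
      raiseFree Z = raise (tabulate (free Z)) Z

      outside-raiseFree : ∀ Z j → outside (raiseFree Z) j ≡ outside Z j
      outside-raiseFree Z j with s j in sj
      ... | true = trans (∧-zeroʳ _) (sym (∧-zeroʳ _))
      ... | false = cong (_∧ true) (raise-outside (tabulate (free Z)) Z j not-free)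
        where
        not-free : lookup (tabulate (free Z)) j ≡ false
        not-free rewrite lookup∘tabulate (free Z) j | sj = refl

      raiseFree-independent : ∀ Z → IsIndependent (lookup Z) → IsIndependent (lookup (raiseFree Z))
      raiseFree-independent Z Z-indep = independent-if (raiseFree Z) W-indep S-part⊆free
        where
        W-indep : IsIndependent (outside (raiseFree Z))
        W-indep = ⊆-independent (outside-independent Z Z-indep)
                    (λ j e → trans (sym (outside-raiseFree Z j)) e)
        S-part⊆free : ∀ j → lookup (raiseFree Z) j ≡ true → s j ≡ true → free (raiseFree Z) j ≡ true
        S-part⊆free j e sj with raise⊆ (tabulate (free Z)) Z j e
        ... | inj₁ Zj = trans (free-cong (raiseFree Z) Z (outside-raiseFree Z) j)
                              (Z∩S⊆free Z Z-indep j Zj sj)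
        ... | inj₂ tj = trans (free-cong (raiseFree Z) Z (outside-raiseFree Z) j)
                              (trans (sym (lookup∘tabulate (free Z) j)) tj)

      -- With T = free Z, α = 2|Z ∖ S| + |T| and |Z| = |Z ∖ S| + |Z ∩ T|, so 2|Z| < α means
      -- |Z ∩ T| < |T ∖ Z|.
      unmatchedOut-raiseFree : ∀ Z → IsIndependent (lookup Z) → suc (∣ Z ∣ + ∣ Z ∣) ≤ α G →
                               1 ≤ unmatchedOut (tabulate (free Z)) Z
      unmatchedOut-raiseFree Z Z-indep 1+2∣Z∣≤α = unmatchedOut-pos t Z (begin
        suc (# (λ j → lookup t j ∧ lookup Z j))  ≡⟨ cong suc (#-cong (t-at lookup)) ⟩
        suc a                                    ≤⟨ +-cancelˡ-≤ (2 * w + a) (suc a) b (begin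
          2 * w + a + suc a      ≡⟨ +-double-suc w a ⟩
          suc ((w + a) + (w + a)) ≡⟨ cong (λ z → suc (z + z)) (∣Z∣≡∣outside∣+∣free∩Z∣ Z Z-indep) ⟨
          suc (∣ Z ∣ + ∣ Z ∣)     ≤⟨ 1+2∣Z∣≤α ⟩
          α G                    ≡⟨ α≡2∣outside∣+∣free∣ Z Z-indep ⟩
          2 * w + # (free Z)     ≡⟨ cong (2 * w +_) (#-split (free Z) (lookup Z)) ⟩
          2 * w + (a + b)        ≡⟨ +-assoc (2 * w) a b ⟨
          2 * w + a + b          ∎) ⟩
        b                                        ≡⟨ #-cong (t-at (λ Z j → not (lookup Z j))) ⟨
        # (λ j → lookup t j ∧ not (lookup Z j))  ∎)
        where
        open ≤-Reasoning
        t : Vec Bool (n G)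
        t = tabulate (free Z)
        w a b : ℕ
        w = # (outside Z)
        a = # (λ j → free Z j ∧ lookup Z j)
        b = # (λ j → free Z j ∧ not (lookup Z j))
        t-at : (f : Subset (n G) → Fin (n G) → Bool) → ∀ j → (lookup t j ∧ f Z j) ≡ (free Z j ∧ f Z j)
        t-at f j = cong (_∧ f Z j) (lookup∘tabulate (free Z) j)
        +-double-suc : ∀ w a → 2 * w + a + suc a ≡ suc ((w + a) + (w + a))
        +-double-suc = solve-∀

      i-rising : ∀ k → suc (k + k) ≤ α G → i G k ≤ i G (suc k)
      i-rising k 1+2k≤α = count-≤ (indepOfSize k) (indepOfSize (suc k)) raiseFree sized injective
        where
        positive : ∀ Z → T (indepOfSize k Z) → 1 ≤ unmatchedOut (tabulate (free Z)) Z
        positive Z h with indepOfSize⁻ k Z h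
        ... | Z-indep , refl = unmatchedOut-raiseFree Z Z-indep 1+2k≤α
        sized : ∀ Z → T (indepOfSize k Z) → T (indepOfSize (suc k) (raiseFree Z))
        sized Z h with indepOfSize⁻ k Z h | positive Z h
        ... | Z-indep , refl | pos =
          indepOfSize⁺ _ (raiseFree Z) (raiseFree-independent Z Z-indep) (∣raise∣ (tabulate (free Z)) Z pos)
        injective : ∀ X Y → T (indepOfSize k X) → T (indepOfSize k Y) → raiseFree X ≡ raiseFree Y → X ≡ Y
        injective X Y hX hY e =
          raise-injective (tabulate (free X)) X Y (positive X hX)
            (subst (λ t → 1 ≤ unmatchedOut t Y) (sym same-free) (positive Y hY))
            (trans e (cong (λ t → raise t Y) (sym same-free)))
          where
          same-outside : ∀ j → outside X j ≡ outside Y j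
          same-outside j = begin
            outside X j               ≡⟨ outside-raiseFree X j ⟨
            outside (raiseFree X) j   ≡⟨ cong (λ Z → outside Z j) e ⟩
            outside (raiseFree Y) j   ≡⟨ outside-raiseFree Y j ⟩
            outside Y j               ∎
            where open ≡-Reasoning
          same-free : tabulate (free X) ≡ tabulate (free Y)
          same-free = tabulate-cong (free-cong X Y same-outside)

      symmetric : Symmetric G
      symmetric = symmetric-from-≤ (i G) (α G) i≤i[α∸]

      unimodal : Unimodal G
      unimodal = symmetric+rising⇒unimodal (i G) (α G) symmetric i-rising

  two-neighbours⇒symmetric∧unimodal : i G (α G) ≡ 1 → PrevCountIsV G →
    (∀ S → IsUniqueMaximum S → ∀ u → lookup S u ≡ false → # (λ j → Adj G u j ∧ lookup S j) ≡ 2) →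
    Symmetric G × Unimodal G
  two-neighbours⇒symmetric∧unimodal i[α]≡1 i[α-1]≡∣V∣ two with i[α]≡1⇒uniqueMaximum i[α]≡1
  ... | S , S-max@(S-indep , ∣S∣≡α , S-unique) = symmetric , unimodal
    where
    open UniqueMaximum S S-indep ∣S∣≡α S-unique
    open TwoNeighbours (two S S-max) i[α-1]≡∣V∣

corollary3p6 : (G : Graph) →
    ((i G (α G) ≡ 1) → PrevCountIsV G →
      (∀ S → Independent G S → ∣ S ∣ ≡ α G → ∀ u → u ∉ S → ∣ N G u ∩ S ∣ ≡ 2) →
      Symmetric G × Unimodal G)
  × (ClawFree G → (i G (α G) ≡ 1) → PrevCountIsV G → Symmetric G × Unimodal G)
corollary3p6 G =
    (λ i[α]≡1 i[α-1]≡∣V∣ two-in-S →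
      two-neighbours⇒symmetric∧unimodal G i[α]≡1 i[α-1]≡∣V∣ λ S (S-indep , ∣S∣≡α , _) u su →
        trans (sym (∣N∩X∣ G u S))
              (two-in-S S (IsIndependent⇒Independent G S S-indep) ∣S∣≡α u (lookup≡false⇒∉ su)))
  , (λ claw-free i[α]≡1 i[α-1]≡∣V∣ →
      two-neighbours⇒symmetric∧unimodal G i[α]≡1 i[α-1]≡∣V∣ λ S (S-indep , ∣S∣≡α , S-unique) →
        UniqueMaximum.claw-free⇒two-neighbours G S S-indep ∣S∣≡α S-unique claw-free)
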